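{- Every singleton or doubleton set of positive integers is the score set of some oriented bipartite graph. That is, for every positive integer $a$ there is an oriented bipartite graph with score set $\{a\}$, and for all positive integers $a_1<a_2$ there is an oriented bipartite graph with score set $\{a_1,a_2\}$.
   Context: An oriented bipartite graph $D(U,V)$ is obtained by assigning a direction to each edge of a simple bipartite graph with parts $U=\{u_1,\dots,u_m\}$ and $V=\{v_1,\dots,v_n\}$. For a vertex $x$, let $d_x^+$ and $d_x^-$ denote its outdegree and indegree. The score of $u\in U$ is $a_u=n+d_u^+-d_u^-$ and the score of $v\in V$ is $b_v=m+d_v^+-d_v^-$. The score set of $D(U,V)$ is the set of distinct scores of all its vertices. -}

module Defs where

open import Data.Nat using (ℕ; zero; suc)
open import Data.Fin using (Fin)
open import Data.List using (List; length; filter; allFin)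
open import Data.Integer using (ℤ; +_; _+_; _-_)
open import Data.Product using (Σ; ∃; _×_; _,_)
open import Data.Sum using (_⊎_)
open import Relation.Binary.PropositionalEquality using (_≡_)
open import Relation.Nullary using (Dec; yes; no)

-- Orientation state of the pair (u_i , v_j) in an oriented bipartite graph:
-- no edge, edge oriented u_i → v_j, or edge oriented v_j → u_i.
-- (Simple underlying graph: at most one edge per pair.)
data Arc : Set where
  none : Arc
  u→v  : Arc
  v→u  : Arc

isU→V : (a : Arc) → Dec (a ≡ u→v)
isU→V none = no (λ ())
isU→V u→v  = yes _≡_.refl
isU→V v→u  = no (λ ())

isV→U : (a : Arc) → Dec (a ≡ v→u)
isV→U none = no (λ ())
isV→U u→v  = no (λ ())
isV→U v→u  = yes _≡_.refl

OBG : ℕ → ℕ → Set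
OBG m n = Fin m → Fin n → Arc

module _ {m n : ℕ} (D : OBG m n) where

  outdegU : Fin m → ℕ
  outdegU i = length (filter (λ j → isU→V (D i j)) (allFin n))

  indegU : Fin m → ℕ
  indegU i = length (filter (λ j → isV→U (D i j)) (allFin n))

  outdegV : Fin n → ℕ
  outdegV j = length (filter (λ i → isV→U (D i j)) (allFin m))

  indegV : Fin n → ℕ
  indegV j = length (filter (λ i → isU→V (D i j)) (allFin m))

  scoreU : Fin m → ℤ
  scoreU i = (+ n + + outdegU i) - + indegU i

  scoreV : Fin n → ℤ
  scoreV j = (+ m + + outdegV j) - + indegV j

  InScoreSet : ℤ → Set
  InScoreSet x = (∃ λ i → scoreU i ≡ x) ⊎ (∃ λ j → scoreV j ≡ x)

HasScoreSet : {m n : ℕ} → OBG m n → (ℤ → Set) → Set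
HasScoreSet D S = ∀ x → (InScoreSet D x → S x) × (S x → InScoreSet D x)

{-# OPTIONS --safe #-}
-- Without edges every vertex of U scores |V| and every vertex of V scores |U|.
-- So the edgeless graph on parts of sizes a₁ and a₂ has score set {a₁, a₂},
-- and the one on two parts of size a has score set {a}. Positivity only
-- serves to make both parts nonempty.
module Submission where

open import Defs
open import Data.Nat using (ℕ; _<_; suc)
open import Data.Fin using (zero)
open import Data.List using (List; []; filter; length; allFin)
open import Data.List.Properties using (filter-none)
import Data.List.Relation.Unary.All as All
open import Data.Integer using (ℤ; +_; _+_; _-_)
open import Data.Integer.Properties using (+-identityʳ)
open import Data.Product using (Σ; _×_; _,_)
open import Data.Sum using (_⊎_; inj₁; inj₂; reduce)
open import Relation.Binary.PropositionalEquality
  using (_≡_; sym; trans; cong; cong₂; module ≡-Reasoning)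
open import Relation.Nullary using (Dec; ¬_)
open import Relation.Unary using (Pred; _≐_)

filter-const-no : ∀ {a p} {A : Set a} {P : Set p} (P? : Dec P) → ¬ P →
                  (xs : List A) → filter (λ _ → P?) xs ≡ []
filter-const-no P? ¬p xs = filter-none (λ _ → P?) (All.universal (λ _ → ¬p) xs)

module _ {m n : ℕ} (D : OBG m n) where

  scoreU-isolated : ∀ i → outdegU D i ≡ 0 → indegU D i ≡ 0 → scoreU D i ≡ + n
  scoreU-isolated i d⁺≡0 d⁻≡0 = begin
    (+ n + + outdegU D i) - + indegU D i  ≡⟨ cong₂ (λ d⁺ d⁻ → (+ n + + d⁺) - + d⁻) d⁺≡0 d⁻≡0 ⟩
    (+ n + + 0) - + 0                      ≡⟨ +-identityʳ _ ⟩
    + n + + 0                              ≡⟨ +-identityʳ _ ⟩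
    + n                                    ∎
    where open ≡-Reasoning

  scoreV-isolated : ∀ j → outdegV D j ≡ 0 → indegV D j ≡ 0 → scoreV D j ≡ + m
  scoreV-isolated j d⁺≡0 d⁻≡0 = begin
    (+ m + + outdegV D j) - + indegV D j  ≡⟨ cong₂ (λ d⁺ d⁻ → (+ m + + d⁺) - + d⁻) d⁺≡0 d⁻≡0 ⟩
    (+ m + + 0) - + 0                      ≡⟨ +-identityʳ _ ⟩
    + m + + 0                              ≡⟨ +-identityʳ _ ⟩
    + m                                    ∎
    where open ≡-Reasoning

HasScoreSet-resp-≐ : ∀ {m n} {D : OBG m n} {S T : Pred ℤ _} →
                     S ≐ T → HasScoreSet D S → HasScoreSet D T
HasScoreSet-resp-≐ (S⊆T , T⊆S) hasS x with hasS x
... | into , onto = (λ d → S⊆T (into d)) , (λ t → onto (T⊆S t))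

edgeless : ∀ {m n} → OBG m n
edgeless _ _ = none

module _ {m n : ℕ} where

  scoreU-edgeless : ∀ i → scoreU (edgeless {m} {n}) i ≡ + n
  scoreU-edgeless i = scoreU-isolated edgeless i
    (cong length (filter-const-no (isU→V none) (λ ()) (allFin n)))
    (cong length (filter-const-no (isV→U none) (λ ()) (allFin n)))

  scoreV-edgeless : ∀ j → scoreV (edgeless {m} {n}) j ≡ + m
  scoreV-edgeless j = scoreV-isolated edgeless j
    (cong length (filter-const-no (isV→U none) (λ ()) (allFin m)))
    (cong length (filter-const-no (isU→V none) (λ ()) (allFin m)))

edgeless-hasScoreSet : ∀ m n →
  HasScoreSet (edgeless {suc m} {suc n}) (λ x → (x ≡ + suc m) ⊎ (x ≡ + suc n))
edgeless-hasScoreSet m n x = into , onto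
  where
  into : InScoreSet (edgeless {suc m} {suc n}) x → (x ≡ + suc m) ⊎ (x ≡ + suc n)
  into (inj₁ (i , sᵢ≡x)) = inj₂ (trans (sym sᵢ≡x) (scoreU-edgeless i))
  into (inj₂ (j , sⱼ≡x)) = inj₁ (trans (sym sⱼ≡x) (scoreV-edgeless j))

  onto : (x ≡ + suc m) ⊎ (x ≡ + suc n) → InScoreSet (edgeless {suc m} {suc n}) x
  onto (inj₁ x≡m) = inj₂ (zero , trans (scoreV-edgeless {suc m} {suc n} zero) (sym x≡m))
  onto (inj₂ x≡n) = inj₁ (zero , trans (scoreU-edgeless {suc m} {suc n} zero) (sym x≡n))

theorem2p1 : (∀ (a : ℕ) → 0 < a →
    Σ ℕ λ m → Σ ℕ λ n → Σ (OBG m n) λ D →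
    HasScoreSet D (λ x → x ≡ + a))
    × (∀ (a₁ a₂ : ℕ) → 0 < a₁ → a₁ < a₂ →
    Σ ℕ λ m → Σ ℕ λ n → Σ (OBG m n) λ D →
    HasScoreSet D (λ x → (x ≡ + a₁) ⊎ (x ≡ + a₂)))
theorem2p1 = singleton , doubleton
  where
  singleton : ∀ (a : ℕ) → 0 < a → Σ ℕ λ m → Σ ℕ λ n → Σ (OBG m n) λ D →
              HasScoreSet D (λ x → x ≡ + a)
  singleton (suc a) _ = suc a , suc a , edgeless ,
    HasScoreSet-resp-≐ {D = edgeless} (reduce , inj₁) (edgeless-hasScoreSet a a)

  doubleton : ∀ (a₁ a₂ : ℕ) → 0 < a₁ → a₁ < a₂ → Σ ℕ λ m → Σ ℕ λ n → Σ (OBG m n) λ D →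
              HasScoreSet D (λ x → (x ≡ + a₁) ⊎ (x ≡ + a₂))
  doubleton (suc a₁) (suc a₂) _ _ = suc a₁ , suc a₂ , edgeless , edgeless-hasScoreSet a₁ a₂
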